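{- Let $p,q$ be propositional variables. There is no formula $\varphi\in\mathsf L_{\mathsf U}$ (built from variables using $\bot,\wedge,\vee,\to,\bigcirc,\mathsf U$) such that $(q\,\mathsf R\,p)\leftrightarrow\varphi$ is valid over the class of finite here-and-there models.
   Context: A model is $(W,\preccurlyeq,S,V)$ with $\preccurlyeq$ a partial order on nonempty $W$, $S\colon W\to W$ forward confluent ($w\preccurlyeq v\Rightarrow S(w)\preccurlyeq S(v)$), and monotone $V\colon W\to\mathcal P(\mathbb P)$. Satisfaction: atoms by $V$; $\bot$ false; $\wedge,\vee$ classical; $w\models\bigcirc\varphi$ iff $S(w)\models\varphi$; $w\models\varphi\to\psi$ iff every $v\succcurlyeq w$ with $v\models\varphi$ has $v\models\psi$; $w\models\varphi\,\mathsf U\,\psi$ iff some $k\ge0$ has $S^k(w)\models\psi$ and $S^i(w)\models\varphi$ for all $i<k$; $w\models\varphi\,\mathsf R\,\psi$ iff for all $k\ge0$, $S^k(w)\models\psi$ or $S^i(w)\models\varphi$ for some $i<k$. A here-and-there model is a model with $W=T\times\{0,1\}$ for some set $T$ such that there is $f\colon T\to T$ with $(t,i)\preccurlyeq(s,j)$ iff $t=s$ and $i\le j$, and $S(t,i)=(f(t),i)$. It is finite if $W$ is finite. -}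

module Defs where

open import Data.Nat using (ℕ; _<_)
open import Data.Bool using (Bool; false; true)
open import Data.Bool.Base using () renaming (_≤_ to _≤ᵇ_)
open import Data.Bool.Properties using () renaming (≤-isPartialOrder to ≤ᵇ-isPartialOrder)
open import Data.Product using (Σ; _×_; _,_; proj₁; proj₂)
open import Data.Sum using (_⊎_)
open import Data.Empty using (⊥)
open import Data.Unit using (⊤)
open import Data.Fin using (Fin)
open import Function.Bundles using (_↔_)
open import Relation.Binary.Structures using (IsPartialOrder; IsPreorder)
open import Relation.Binary.PropositionalEquality
  using (_≡_; refl; sym; trans; cong; cong₂; isEquivalence; subst)
open import Relation.Nullary using (¬_)

Atom : Set
Atom = ℕ

infixr 5 _⇒_
data Form : Set where
  var  : Atom → Form
  ⊥'   : Form
  _∧'_ : Form → Form → Form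
  _∨'_ : Form → Form → Form
  _⇒_  : Form → Form → Form
  ○    : Form → Form
  _U_  : Form → Form → Form
  _R_  : Form → Form → Form

_⇔'_ : Form → Form → Form
φ ⇔' ψ = (φ ⇒ ψ) ∧' (ψ ⇒ φ)

data InLU : Form → Set where
  var  : ∀ a → InLU (var a)
  ⊥'   : InLU ⊥'
  _∧'_ : ∀ {φ ψ} → InLU φ → InLU ψ → InLU (φ ∧' ψ)
  _∨'_ : ∀ {φ ψ} → InLU φ → InLU ψ → InLU (φ ∨' ψ)
  _⇒_  : ∀ {φ ψ} → InLU φ → InLU ψ → InLU (φ ⇒ ψ)
  ○    : ∀ {φ} → InLU φ → InLU (○ φ)
  _U_  : ∀ {φ ψ} → InLU φ → InLU ψ → InLU (φ U ψ)

record Model : Set₁ where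
  field
    W        : Set
    nonempty : W
    _≼_      : W → W → Set
    isPO     : IsPartialOrder _≡_ _≼_
    S        : W → W
    confl    : ∀ {w v} → w ≼ v → S w ≼ S v
    V        : W → Atom → Set
    V-mono   : ∀ {w v a} → w ≼ v → V w a → V v a

iter : {A : Set} → (A → A) → ℕ → A → A
iter f ℕ.zero x = x
iter f (ℕ.suc n) x = f (iter f n x)

module _ (M : Model) where
  open Model M
  infix 4 _⊨_
  _⊨_ : W → Form → Set
  w ⊨ var a = V w a
  w ⊨ ⊥' = ⊥
  w ⊨ (φ ∧' ψ) = (w ⊨ φ) × (w ⊨ ψ)
  w ⊨ (φ ∨' ψ) = (w ⊨ φ) ⊎ (w ⊨ ψ)
  w ⊨ (φ ⇒ ψ) = ∀ v → w ≼ v → v ⊨ φ → v ⊨ ψ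
  w ⊨ ○ φ = S w ⊨ φ
  w ⊨ (φ U ψ) = Σ ℕ λ k → (iter S k w ⊨ ψ) × (∀ i → i < k → iter S i w ⊨ φ)
  w ⊨ (φ R ψ) = ∀ k → (iter S k w ⊨ ψ) ⊎ Σ ℕ (λ i → (i < k) × (iter S i w ⊨ φ))

module _ (T : Set) where
  _≼HT_ : T × Bool → T × Bool → Set
  (t , i) ≼HT (s , j) = (t ≡ s) × (i ≤ᵇ j)

  private module B = IsPartialOrder ≤ᵇ-isPartialOrder

  ≼HT-isPO : IsPartialOrder _≡_ _≼HT_
  ≼HT-isPO = record
    { isPreorder = record
      { isEquivalence = isEquivalence
      ; reflexive = λ { refl → refl , B.refl }
      ; trans = λ { (p , a) (q , b) → trans p q , B.trans a b } }
    ; antisym = λ { (p , a) (_ , b) → cong₂ _,_ p (B.antisym a b) } }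

htModel : (T : Set) → T → (f : T → T) → (V : T × Bool → Atom → Set)
        → (∀ {w v a} → _≼HT_ T w v → V w a → V v a) → Model
htModel T t₀ f V mono = record
  { W = T × Bool
  ; nonempty = t₀ , false
  ; _≼_ = _≼HT_ T
  ; isPO = ≼HT-isPO T
  ; S = λ { (t , i) → f t , i }
  ; confl = λ { (refl , a) → refl , a }
  ; V = V
  ; V-mono = mono }

IsFinite : Model → Set
IsFinite M = Σ ℕ λ n → Model.W M ↔ Fin n

ValidFinHT : Form → Set₁
ValidFinHT φ =
  (T : Set) (t₀ : T) (f : T → T) (V : T × Bool → Atom → Set)
  (mono : ∀ {w v a} → _≼HT_ T w v → V w a → V v a) →
  let M = htModel T t₀ f V mono in
  IsFinite M → (w : Model.W M) → _⊨_ M w φ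

-- Truth in L_U cannot see arbitrarily far ahead: ○ is the only connective that moves
-- along the successor, so a formula of ○-depth d is only sensitive to the first d
-- steps. Take the here-and-there chain t_N → t_{N-1} → … → t₀ → t₀ with N > d in
-- which p holds at every "there" world and at every "here" world except (t₀, 0), and q
-- holds nowhere. The "there" layer is homogeneous, so U collapses there (ψ eventually
-- means ψ now) and every L_U formula of depth d true at (t_N, 1) is already true at
-- (t_N, 0). But q R p holds at (t_N, 1) and fails at (t_N, 0), p failing N steps later.
module Submission where

open import Defs
open import Data.Nat using (ℕ; zero; suc; _≤_; _<_; _⊔_; _*_; s≤s)
open import Data.Nat.Properties using (m⊔n≤o⇒m≤o; m⊔n≤o⇒n≤o; ≤-refl; suc-injective)
open import Data.Bool using (Bool; true; false)
open import Data.Bool.Base using (b≤b; f≤t)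
open import Data.Fin using (Fin; toℕ; fromℕ; pred; inject₁) renaming (zero to fzero; suc to fsuc)
open import Data.Fin.Properties using (*↔×; 2↔Bool; toℕ-inject₁; toℕ-fromℕ)
open import Data.Product using (Σ; _×_; _,_; proj₁; proj₂)
open import Data.Product.Function.NonDependent.Propositional using (_×-↔_)
open import Data.Sum using (inj₁; inj₂)
open import Function.Bundles using (_↔_)
open import Function.Properties.Inverse using (↔-refl; ↔-sym; ↔-trans)
open import Relation.Binary.PropositionalEquality using (_≡_; _≢_; refl; sym; trans; cong; subst)
open import Relation.Binary.Structures using (IsPartialOrder)
open import Relation.Nullary using (¬_)

nextDepth : Form → ℕ
nextDepth (var _)  = 0
nextDepth ⊥'       = 0
nextDepth (φ ∧' ψ) = nextDepth φ ⊔ nextDepth ψ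
nextDepth (φ ∨' ψ) = nextDepth φ ⊔ nextDepth ψ
nextDepth (φ ⇒ ψ)  = nextDepth φ ⊔ nextDepth ψ
nextDepth (○ φ)    = suc (nextDepth φ)
nextDepth (φ U ψ)  = nextDepth φ ⊔ nextDepth ψ
nextDepth (φ R ψ)  = nextDepth φ ⊔ nextDepth ψ

iter-suc : {A : Set} (f : A → A) (k : ℕ) (x : A) → iter f (suc k) x ≡ iter f k (f x)
iter-suc f zero    x = refl
iter-suc f (suc k) x = cong f (iter-suc f k x)

iter-pred-toℕ : ∀ {n} k (i : Fin (suc n)) → toℕ i ≡ k → iter pred k i ≡ fzero
iter-pred-toℕ zero    fzero    _  = refl
iter-pred-toℕ (suc k) (fsuc i) eq =
  trans (iter-suc pred k (fsuc i))
        (iter-pred-toℕ k (inject₁ i) (trans (toℕ-inject₁ i) (suc-injective eq)))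

module _ (M : Model) where
  open Model M
  open IsPartialOrder isPO using () renaming (trans to ≼-trans)

  iter-S-mono : ∀ k {w v} → w ≼ v → iter S k w ≼ iter S k v
  iter-S-mono zero    w≼v = w≼v
  iter-S-mono (suc k) w≼v = confl (iter-S-mono k w≼v)

  ⊨-mono : ∀ φ {w v} → w ≼ v → _⊨_ M w φ → _⊨_ M v φ
  ⊨-mono (var a)  w≼v h                = V-mono w≼v h
  ⊨-mono (φ ∧' ψ) w≼v (hφ , hψ)        = ⊨-mono φ w≼v hφ , ⊨-mono ψ w≼v hψ
  ⊨-mono (φ ∨' ψ) w≼v (inj₁ hφ)        = inj₁ (⊨-mono φ w≼v hφ)
  ⊨-mono (φ ∨' ψ) w≼v (inj₂ hψ)        = inj₂ (⊨-mono ψ w≼v hψ)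
  ⊨-mono (φ ⇒ ψ)  w≼v h u v≼u          = h u (≼-trans w≼v v≼u)
  ⊨-mono (○ φ)    w≼v h                = ⊨-mono φ (confl w≼v) h
  ⊨-mono (φ U ψ)  w≼v (k , hψ , hφ)    =
    k , ⊨-mono ψ (iter-S-mono k w≼v) hψ , λ i i<k → ⊨-mono φ (iter-S-mono i w≼v) (hφ i i<k)
  ⊨-mono (φ R ψ)  w≼v h k with h k
  ... | inj₁ hψ            = inj₁ (⊨-mono ψ (iter-S-mono k w≼v) hψ)
  ... | inj₂ (i , i<k , hφ) = inj₂ (i , i<k , ⊨-mono φ (iter-S-mono i w≼v) hφ)

htModel-finite : ∀ {T : Set} {n} (t₀ : T) (f : T → T) (V : T × Bool → Atom → Set)
                 (mono : ∀ {w v a} → _≼HT_ T w v → V w a → V v a) →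
                 T ↔ Fin n → IsFinite (htModel T t₀ f V mono)
htModel-finite {n = n} _ _ _ _ T↔Fin = n * 2 , ↔-sym (↔-trans *↔× (↔-sym T↔Fin ×-↔ 2↔Bool))

module HereAndThere (T : Set) (t₀ : T) (f : T → T) (V : T × Bool → Atom → Set)
                    (mono : ∀ {w v a} → _≼HT_ T w v → V w a → V v a) where

  M : Model
  M = htModel T t₀ f V mono

  open Model M using (S)

  infix 4 _⊩_
  _⊩_ : T × Bool → Form → Set
  _⊩_ = _⊨_ M

  iter-S : ∀ k t b → iter S k (t , b) ≡ (iter f k t , b)
  iter-S zero    t b = refl
  iter-S (suc k) t b = cong S (iter-S k t b)

  ThereConstant : Set
  ThereConstant = ∀ t s a → V (t , true) a → V (s , true) a

  there-invariant : ThereConstant → ∀ φ t s → (t , true) ⊩ φ → (s , true) ⊩ φ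
  there-invariant const (var a)  t s h               = const t s a h
  there-invariant const (φ ∧' ψ) t s (hφ , hψ)       =
    there-invariant const φ t s hφ , there-invariant const ψ t s hψ
  there-invariant const (φ ∨' ψ) t s (inj₁ hφ)       = inj₁ (there-invariant const φ t s hφ)
  there-invariant const (φ ∨' ψ) t s (inj₂ hψ)       = inj₂ (there-invariant const ψ t s hψ)
  there-invariant const (φ ⇒ ψ)  t s h (.s , true) (refl , _) hφ =
    there-invariant const ψ t s (h (t , true) (refl , b≤b) (there-invariant const φ s t hφ))
  there-invariant const (○ φ)    t s h               = there-invariant const φ (f t) (f s) h
  there-invariant const (φ U ψ)  t s (k , hψ , _)    =
    0 , there-invariant const ψ (iter f k t) s (subst (_⊩ ψ) (iter-S k t true) hψ) , λ _ ()
  there-invariant const (φ R ψ)  t s h k with h 0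
  ... | inj₁ hψ = inj₁ (subst (_⊩ ψ) (sym (iter-S k s true))
                               (there-invariant const ψ t (iter f k s) hψ))

  ThereImpliesHere : T → Set
  ThereImpliesHere t = ∀ a → V (t , true) a → V (t , false) a

  ThereImpliesHereFor : ℕ → T → Set
  ThereImpliesHereFor zero    t = ThereImpliesHere t
  ThereImpliesHereFor (suc m) t = ThereImpliesHere t × ThereImpliesHereFor m (f t)

  thereImpliesHere-now : ∀ m {t} → ThereImpliesHereFor m t → ThereImpliesHere t
  thereImpliesHere-now zero    h = h
  thereImpliesHere-now (suc m) h = proj₁ h

  there⇒here : ThereConstant → ∀ {φ} → InLU φ → ∀ m t → nextDepth φ ≤ m →
               ThereImpliesHereFor m t → (t , true) ⊩ φ → (t , false) ⊩ φ
  there⇒here const (var a) m t _ agree h = thereImpliesHere-now m agree a h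
  there⇒here const (_∧'_ {φ} {ψ} lφ lψ) m t d agree (hφ , hψ) =
    there⇒here const lφ m t (m⊔n≤o⇒m≤o (nextDepth φ) _ d) agree hφ ,
    there⇒here const lψ m t (m⊔n≤o⇒n≤o (nextDepth φ) _ d) agree hψ
  there⇒here const (_∨'_ {φ} lφ _) m t d agree (inj₁ hφ) =
    inj₁ (there⇒here const lφ m t (m⊔n≤o⇒m≤o (nextDepth φ) _ d) agree hφ)
  there⇒here const (_∨'_ {φ} _ lψ) m t d agree (inj₂ hψ) =
    inj₂ (there⇒here const lψ m t (m⊔n≤o⇒n≤o (nextDepth φ) _ d) agree hψ)
  there⇒here const (_ ⇒ _) m t d agree h (.t , true) (refl , _) hφ =
    h (t , true) (refl , b≤b) hφ
  there⇒here const (_⇒_ {φ} _ lψ) m t d agree h (.t , false) (refl , _) hφ =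
    there⇒here const lψ m t (m⊔n≤o⇒n≤o (nextDepth φ) _ d) agree
      (h (t , true) (refl , b≤b) (⊨-mono M φ (refl , f≤t) hφ))
  there⇒here const (○ lφ) (suc m) t (s≤s d) (_ , agree) h =
    there⇒here const lφ m (f t) d agree h
  there⇒here const (_U_ {φ} {ψ} _ lψ) m t d agree (k , hψ , _) =
    0 , there⇒here const lψ m t (m⊔n≤o⇒n≤o (nextDepth φ) _ d) agree
          (there-invariant const ψ (iter f k t) t (subst (_⊩ ψ) (iter-S k t true) hψ))
      , λ _ ()

module Countermodel (p : Atom) (N : ℕ) where

  Val : Fin (suc N) × Bool → Atom → Set
  Val (_ , true)  a = a ≡ p
  Val (i , false) a = (a ≡ p) × (i ≢ fzero)

  Val-mono : ∀ {w v a} → _≼HT_ (Fin (suc N)) w v → Val w a → Val v a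
  Val-mono {_ , false} {_ , false} (refl , _) h = h
  Val-mono {_ , false} {_ , true}  (refl , _) h = proj₁ h
  Val-mono {_ , true}  {_ , true}  (refl , _) h = h

  open HereAndThere (Fin (suc N)) fzero pred Val Val-mono public

  thereConstant : ThereConstant
  thereConstant _ _ _ a≡p = a≡p

  thereImpliesHereFor : ∀ m (i : Fin (suc N)) → m < toℕ i → ThereImpliesHereFor m i
  thereImpliesHereFor zero    (fsuc i) _       _ a≡p = a≡p , λ ()
  thereImpliesHereFor (suc m) (fsuc i) (s≤s m<i) =
    (λ _ a≡p → a≡p , λ ()) ,
    thereImpliesHereFor m (inject₁ i) (subst (m <_) (sym (toℕ-inject₁ i)) m<i)

  there⇒here-fromℕ : ∀ {φ} → InLU φ → nextDepth φ < N →
                     (fromℕ N , true) ⊩ φ → (fromℕ N , false) ⊩ φ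
  there⇒here-fromℕ {φ} φ∈LU d<N =
    there⇒here thereConstant φ∈LU (nextDepth φ) (fromℕ N) ≤-refl
      (thereImpliesHereFor (nextDepth φ) (fromℕ N) (subst (nextDepth φ <_) (sym (toℕ-fromℕ N)) d<N))

  release-there : ∀ q i → (i , true) ⊩ var q R var p
  release-there q i k = inj₁ (subst (_⊩ var p) (sym (iter-S k i true)) refl)

  release-fails-here : ∀ {q} → p ≢ q → ∀ i → ¬ (i , false) ⊩ var q R var p
  release-fails-here p≢q i h with h (toℕ i)
  ... | inj₁ hp =
    proj₂ (subst (_⊩ var p) (iter-S (toℕ i) i false) hp) (iter-pred-toℕ (toℕ i) i refl)
  ... | inj₂ (j , _ , hq) = p≢q (sym (proj₁ (subst (_⊩ var _) (iter-S j i false) hq)))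

corollary8p2 : (p q : Atom) → p ≢ q →
    ¬ Σ Form (λ φ → InLU φ × ValidFinHT ((var q R var p) ⇔' φ))
corollary8p2 p q p≢q (φ , φ∈LU , valid) =
  release-fails-here p≢q start (proj₂ (equiv (start , false)) (start , false) (refl , b≤b) φ-here)
  where
  open Countermodel p (suc (nextDepth φ))

  start : Fin (suc (suc (nextDepth φ)))
  start = fromℕ (suc (nextDepth φ))

  equiv : ∀ w → w ⊩ ((var q R var p) ⇔' φ)
  equiv = valid _ fzero pred Val Val-mono (htModel-finite fzero pred Val Val-mono ↔-refl)

  φ-here : (start , false) ⊩ φ
  φ-here = there⇒here-fromℕ φ∈LU ≤-refl
             (proj₁ (equiv (start , true)) (start , true) (refl , b≤b) (release-there q start))
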